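{- The classes $\mathsf{FH}$ and $\mathsf{FI}$ do not have the fixed-point property.
   Context: Language $\mathcal{L}$: countably many individual variables, Boolean constants $\top,\bot$, connectives $\neg,\to$, the quantifier $\forall$, the modal operator $\Box$, and countably many predicate symbols of each arity (no function symbols, constants or equality). Formulas: $\top$, $\bot$, $P(u_1,\ldots,u_n)$, closed under $\neg$, $\to$, $\forall u$, $\Box$. $\mathcal{L}'$ is $\mathcal{L}$ together with one fixed propositional variable $p$. For an $\mathcal{L}'$-formula $A(p)$ and $\mathcal{L}$-formula $B$, $A(B)$ is the result of replacing every occurrence of $p$ by $B$. $A(p)$ is modalized in $p$ if every occurrence of $p$ lies within the scope of a $\Box$. Kripke frame: $\mathcal{F}=\langle W,\prec,\{D_w\}_{w\in W}\rangle$, $W\neq\emptyset$, $\prec$ binary relation on $W$, each $D_w$ nonempty with $D_w\subseteq D_{w'}$ whenever $w\prec w'$. Interpretations assign to each world and $n$-ary predicate an $n$-ary relation on $D_w$; truth is standard ($\forall$ ranges over $D_w$, $\Box A$ true at $w$ iff $A$ true at all $\prec$-successors). $\mathcal{F}\models A$ means the universal closure of $A$ is true at every world under every interpretation. A frame is conversely well-founded if there is no infinite sequence $w_0\prec w_1\prec\cdots$; then the height is $h(w)=\sup\{h(v)+1: w\prec v\}$ ($\sup\emptyset=0$), and the height of the frame is $\sup_{w\in W}h(w)$. $\mathsf{FH}$ is the class of transitive, conversely well-founded frames of finite height; $\mathsf{FI}$ is the class of frames with $W$ finite and $\prec$ transitive and irreflexive. A class $\mathsf{C}$ of frames has the fixed-point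 property if for every $\mathcal{L}'$-formula $A(p)$ modalized in $p$ there exists an $\mathcal{L}$-formula $B$ containing only predicate symbols occurring in $A$ such that $\mathcal{F}\models B\leftrightarrow A(B)$ for every $\mathcal{F}\in\mathsf{C}$. -}

module Defs where

open import Data.Nat using (ℕ; zero; suc)
open import Data.Fin using (Fin)
open import Data.Vec using (Vec; []; _∷_; map)
open import Data.Bool using (Bool; true; false)
open import Data.Product using (Σ; ∃; _×_; _,_)
open import Data.Sum using (_⊎_)
open import Data.Empty using () renaming (⊥ to Empty)
open import Data.Unit using () renaming (⊤ to Unit)
open import Relation.Nullary using (¬_)
open import Relation.Binary.PropositionalEquality using (_≡_)
open import Data.Nat using (_≟_)
open import Relation.Nullary using (yes; no)

-- Predicate symbols
-- are pairs (n , k) : arity n, index k (countably many of each arity).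
-- Fm' is the language L' (with the fixed propositional variable p);
-- Fm is the language L (no p).

data Fm : Set where
  ⊤ᶠ ⊥ᶠ : Fm
  atom  : (n k : ℕ) → Vec ℕ n → Fm
  ¬ᶠ_   : Fm → Fm
  _⇒_   : Fm → Fm → Fm
  ∀ᶠ    : ℕ → Fm → Fm
  □_    : Fm → Fm

data Fm' : Set where
  ‵p    : Fm'
  ⊤ᶠ ⊥ᶠ : Fm'
  atom  : (n k : ℕ) → Vec ℕ n → Fm'
  ¬ᶠ_   : Fm' → Fm'
  _⇒_   : Fm' → Fm' → Fm'
  ∀ᶠ    : ℕ → Fm' → Fm'
  □_    : Fm' → Fm'

subst-p : Fm' → Fm → Fm
subst-p ‵p B = B
subst-p ⊤ᶠ B = ⊤ᶠ
subst-p ⊥ᶠ B = ⊥ᶠ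
subst-p (atom n k xs) B = atom n k xs
subst-p (¬ᶠ A) B = ¬ᶠ subst-p A B
subst-p (A ⇒ A₁) B = subst-p A B ⇒ subst-p A₁ B
subst-p (∀ᶠ x A) B = ∀ᶠ x (subst-p A B)
subst-p (□ A) B = □ subst-p A B

Modalized : Fm' → Set
Modalized ‵p = Empty
Modalized ⊤ᶠ = Unit
Modalized ⊥ᶠ = Unit
Modalized (atom n k xs) = Unit
Modalized (¬ᶠ A) = Modalized A
Modalized (A ⇒ A₁) = Modalized A × Modalized A₁
Modalized (∀ᶠ x A) = Modalized A
Modalized (□ A) = Unit

Occurs : ℕ → ℕ → Fm → Set
Occurs n k ⊤ᶠ = Empty
Occurs n k ⊥ᶠ = Empty
Occurs n k (atom m j xs) = (n ≡ m) × (k ≡ j)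
Occurs n k (¬ᶠ A) = Occurs n k A
Occurs n k (A ⇒ B) = Occurs n k A ⊎ Occurs n k B
Occurs n k (∀ᶠ x A) = Occurs n k A
Occurs n k (□ A) = Occurs n k A

Occurs' : ℕ → ℕ → Fm' → Set
Occurs' n k ‵p = Empty
Occurs' n k ⊤ᶠ = Empty
Occurs' n k ⊥ᶠ = Empty
Occurs' n k (atom m j xs) = (n ≡ m) × (k ≡ j)
Occurs' n k (¬ᶠ A) = Occurs' n k A
Occurs' n k (A ⇒ B) = Occurs' n k A ⊎ Occurs' n k B
Occurs' n k (∀ᶠ x A) = Occurs' n k A
Occurs' n k (□ A) = Occurs' n k A

-- Kripke frames with expanding domains.  Domains are subsets D w of a
-- fixed carrier U; D w ⊆ D w' whenever w ≺ w'.

record Frame : Set₁ where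
  field
    W       : Set
    _≺_     : W → W → Set
    inhabW  : W
    U       : Set
    D       : W → U → Set
    Dne     : (w : W) → Σ U (D w)
    Dmono   : {w w' : W} {d : U} → w ≺ w' → D w d → D w' d

module _ (F : Frame) where
  open Frame F

  -- an interpretation: at each world, an n-ary relation for each
  -- predicate symbol (n , k) (only its restriction to D w matters)
  Interp : Set₁
  Interp = W → (n k : ℕ) → Vec U n → Set

  Assign : Set
  Assign = ℕ → U

  update : Assign → ℕ → U → Assign
  update ρ x d y with x ≟ y
  ... | yes _ = d
  ... | no  _ = ρ y

  ⟦_⟧ : Fm → Interp → W → Assign → Set
  ⟦ ⊤ᶠ ⟧ I w ρ = Unit
  ⟦ ⊥ᶠ ⟧ I w ρ = Empty
  ⟦ atom n k xs ⟧ I w ρ = I w n k (map ρ xs)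
  ⟦ ¬ᶠ A ⟧ I w ρ = ¬ ⟦ A ⟧ I w ρ
  ⟦ A ⇒ B ⟧ I w ρ = ⟦ A ⟧ I w ρ → ⟦ B ⟧ I w ρ
  ⟦ ∀ᶠ x A ⟧ I w ρ = (d : U) → D w d → ⟦ A ⟧ I w (update ρ x d)
  ⟦ □ A ⟧ I w ρ = (v : W) → w ≺ v → ⟦ A ⟧ I v ρ

  -- assignments into D w (universal closure)
  Admissible : W → Assign → Set
  Admissible w ρ = (x : ℕ) → D w (ρ x)

  ValidIff : Fm → Fm → Set₁
  ValidIff B C = (I : Interp) (w : W) (ρ : Assign) → Admissible w ρ →
                 (⟦ B ⟧ I w ρ → ⟦ C ⟧ I w ρ) × (⟦ C ⟧ I w ρ → ⟦ B ⟧ I w ρ)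

  Transitive : Set
  Transitive = {u v w : W} → u ≺ v → v ≺ w → u ≺ w

  Irreflexive : Set
  Irreflexive = {w : W} → ¬ (w ≺ w)

  ConverselyWellFounded : Set
  ConverselyWellFounded = ¬ (Σ (ℕ → W) λ f → (i : ℕ) → f i ≺ f (suc i))

  -- HeightLe n w  ⇔  h(w) ≤ n, where h(w) = sup { h(v)+1 : w ≺ v }
  HeightLe : ℕ → W → Set
  HeightLe zero w = (v : W) → ¬ (w ≺ v)
  HeightLe (suc n) w = (v : W) → w ≺ v → HeightLe n v

  FiniteHeight : Set
  FiniteHeight = Σ ℕ λ n → (w : W) → HeightLe n w

  FiniteW : Set
  FiniteW = Σ ℕ λ n → Σ (Fin n → W) λ f → (w : W) → ∃ λ i → f i ≡ w

FH : Frame → Set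
FH F = Transitive F × ConverselyWellFounded F × FiniteHeight F

FI : Frame → Set
FI F = FiniteW F × Transitive F × Irreflexive F

FixedPointProperty : (Frame → Set) → Set₁
FixedPointProperty C =
  (A : Fm') → Modalized A →
  Σ Fm λ B → ((n k : ℕ) → Occurs n k B → Occurs' n k A) ×
             ((F : Frame) → C F → ValidIff F B (subst-p A B))

module Submission where

-- Counterexample formula:  A(p) = ∀x (Q x → □ (R x → ¬ p)).
-- Test frames: the finite strict chains  Chain L  with worlds 0,…,L, where
-- each world sees exactly the smaller ones and world w has domain {w, w+1, …}.
-- They are transitive, irreflexive, finite and of finite height, hence lie in
-- both classes.  Under the interpretation "Q x ⇔ x is w, R x ⇔ x is w+1" at
-- world w, A(B) holds at w iff w = 0 or B fails at w − 1; so any fixed point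
-- B must hold exactly at the even worlds (fixedPoint-parity).
-- On the other hand a formula can only see capped distances between worlds
-- and the values of its variables: if its modal depth (counting 2 per box)
-- is n, it cannot separate two worlds that both lie at height ≥ n, provided
-- its variables are far away (invariance).  Taking L = n + 1, worlds n and
-- n + 1 then receive the same truth value from B although their parities
-- differ, a contradiction.

open import Defs
open import Data.Bool using (Bool; true; false; not)
open import Data.Empty using () renaming (⊥ to Empty)
open import Data.Fin using (Fin; toℕ; fromℕ<)
open import Data.Fin.Properties using (toℕ<n; toℕ≤pred[n]; toℕ-fromℕ<)
open import Data.Nat
  using (ℕ; zero; suc; _+_; _∸_; _⊓_; _⊔_; _≤_; _<_; s≤s; _≟_)
open import Data.Nat.Properties
  using ( ≤-refl; ≤-trans; ≤-reflexive; ≤-antisym; ≤-pred; <⇒≤; n≤1+n; <-trans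
        ; <-irrefl; m≤m+n; m≤m⊔n; m≤n⊔m; m≤n⇒m<n∨m≡n; suc-injective
        ; m∸n+n≡m; +-∸-assoc; m+n∸n≡m; m+n∸m≡n; n∸n≡0; m∸n≡0⇒m≤n
        ; m+n≤o⇒m≤o∸n; ⊓-assoc; ⊓-idem; ⊓-monoˡ-≤; m⊓n≤m; m≥n⇒m⊓n≡n
        ; +-distribˡ-⊓ )
open import Data.Product using (Σ; _×_; _,_; proj₁; proj₂)
open import Data.Sum using (inj₁; inj₂)
open import Data.Vec using (Vec; []; _∷_; map)
open import Data.Vec.Properties using (map-∘; map-cong)
open import Function using (_∘_)
open import Relation.Nullary using (¬_; yes; no)
open import Relation.Binary.PropositionalEquality
  using (_≡_; refl; sym; trans; cong; cong₂; subst; module ≡-Reasoning)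

open ≡-Reasoning

-- Formulas only distinguish the distances 0, 1 and "at least 2".
cap : ℕ → ℕ
cap zero = 0
cap (suc zero) = 1
cap (suc (suc _)) = 2

cap-idem : ∀ n → cap (cap n) ≡ cap n
cap-idem zero = refl
cap-idem (suc zero) = refl
cap-idem (suc (suc n)) = refl

cap-+ : ∀ m n → cap (m + n) ≡ cap (cap m + cap n)
cap-+ zero n = sym (cap-idem n)
cap-+ (suc zero) zero = refl
cap-+ (suc zero) (suc zero) = refl
cap-+ (suc zero) (suc (suc n)) = refl
cap-+ (suc (suc m)) n = refl

cap-≥2 : ∀ {n} → 2 ≤ n → cap n ≡ 2
cap-≥2 (s≤s (s≤s _)) = refl

cap≡0 : ∀ {n} → cap n ≡ 0 → n ≡ 0
cap≡0 {zero} _ = refl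
cap≡0 {suc zero} ()
cap≡0 {suc (suc _)} ()

cap≡1 : ∀ {n} → cap n ≡ 1 → n ≡ 1
cap≡1 {zero} ()
cap≡1 {suc zero} _ = refl
cap≡1 {suc (suc _)} ()

offset : ℕ → ℕ → ℕ
offset a d = cap (d ∸ a)

offset-self : ∀ a → offset a a ≡ 0
offset-self a = cong cap (n∸n≡0 a)

offset-suc : ∀ a → offset a (suc a) ≡ 1
offset-suc a = cong cap (m+n∸n≡m 1 a)

offset-far : ∀ {c a} → 2 + c ≤ a → offset c a ≡ 2
offset-far {c} le = cap-≥2 (m+n≤o⇒m≤o∸n 2 le)

offset≡0 : ∀ {a d} → a ≤ d → offset a d ≡ 0 → d ≡ a
offset≡0 a≤d e = ≤-antisym (m∸n≡0⇒m≤n (cap≡0 e)) a≤d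

m∸n≡1⇒m≡1+n : ∀ m n → m ∸ n ≡ 1 → m ≡ suc n
m∸n≡1⇒m≡1+n m zero e = e
m∸n≡1⇒m≡1+n (suc m) (suc n) e = cong suc (m∸n≡1⇒m≡1+n m n e)

offset≡1 : ∀ {a d} → offset a d ≡ 1 → d ≡ suc a
offset≡1 {a} {d} e = m∸n≡1⇒m≡1+n d a (cap≡1 e)

offset-shift : ∀ a k → offset a (a + cap k) ≡ cap k
offset-shift a k = trans (cong cap (m+n∸m≡n a (cap k))) (cap-idem k)

offset-trans : ∀ {c a d} → c ≤ a → a ≤ d → offset c d ≡ cap (offset a d + offset c a)
offset-trans {c} {a} {d} c≤a a≤d = begin
  cap (d ∸ c)                ≡⟨ cong (λ x → cap (x ∸ c)) (sym (m∸n+n≡m a≤d)) ⟩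
  cap ((d ∸ a) + a ∸ c)      ≡⟨ cong cap (+-∸-assoc (d ∸ a) c≤a) ⟩
  cap ((d ∸ a) + (a ∸ c))    ≡⟨ cap-+ (d ∸ a) (a ∸ c) ⟩
  cap (offset a d + offset c a) ∎

-- Agree n a b : a and b coincide, or both are at least n.
Agree : ℕ → ℕ → ℕ → Set
Agree n a b = a ⊓ n ≡ b ⊓ n

agree-mono : ∀ {m n a b} → m ≤ n → Agree n a b → Agree m a b
agree-mono {m} {n} {a} {b} m≤n e = begin
  a ⊓ m          ≡⟨ cong (a ⊓_) (sym (m≥n⇒m⊓n≡n m≤n)) ⟩
  a ⊓ (n ⊓ m)    ≡⟨ sym (⊓-assoc a n m) ⟩
  (a ⊓ n) ⊓ m    ≡⟨ cong (_⊓ m) e ⟩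
  (b ⊓ n) ⊓ m    ≡⟨ ⊓-assoc b n m ⟩
  b ⊓ (n ⊓ m)    ≡⟨ cong (b ⊓_) (m≥n⇒m⊓n≡n m≤n) ⟩
  b ⊓ m          ∎

agree-above : ∀ {n a b} → n ≤ a → n ≤ b → Agree n a b
agree-above n≤a n≤b = trans (m≥n⇒m⊓n≡n n≤a) (sym (m≥n⇒m⊓n≡n n≤b))

-- The back-and-forth step for boxes: if a and b agree up to n + 2, every
-- c' below b is matched by some c below a that agrees with it up to n and
-- lies at the same capped distance below a as c' lies below b.
agree-successor : ∀ {n a b c'} → Agree (2 + n) a b → c' < b →
                  Σ ℕ λ c → c < a × Agree n c c' × offset c a ≡ offset c' b
agree-successor {n} {a} {b} {c'} e c'<b with m≤n⇒m<n∨m≡n c'<b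
... | inj₂ refl = immediate a e
  where
    -- c' is directly below b: take the point directly below a
    immediate : ∀ a → Agree (2 + n) a (suc c') →
                Σ ℕ λ c → c < a × Agree n c c' × offset c a ≡ offset c' (suc c')
    immediate (suc a₀) e = a₀ , ≤-refl , agree-mono (n≤1+n n) (suc-injective e)
                         , trans (offset-suc a₀) (sym (offset-suc c'))
... | inj₁ c'+2≤b =
  c' ⊓ n , ≤-trans (n≤1+n _) far , agreeing , trans (offset-far far) (sym (offset-far c'+2≤b))
  where
    -- c' is far below b: truncate it at n, which is far below a
    far : 2 + (c' ⊓ n) ≤ a
    far = ≤-trans (≤-reflexive (+-distribˡ-⊓ 2 c' n))
            (≤-trans (⊓-monoˡ-≤ (2 + n) c'+2≤b) (≤-trans (≤-reflexive (sym e)) (m⊓n≤m a (2 + n))))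
    agreeing : Agree n (c' ⊓ n) c'
    agreeing = trans (⊓-assoc c' n n) (cong (c' ⊓_) (⊓-idem n))

finiteHeight⇒cwf : (F : Frame) → FiniteHeight F → ConverselyWellFounded F
finiteHeight⇒cwf F (h , bounded) (f , ascending) = noChainFrom h 0 (bounded (f 0))
  where
    noChainFrom : ∀ k i → HeightLe F k (f i) → Empty
    noChainFrom zero i hl = hl (f (suc i)) (ascending i)
    noChainFrom (suc k) i hl = noChainFrom k (suc i) (hl (f (suc i)) (ascending i))

Chain : ℕ → Frame
Chain L = record
  { W = Fin (suc L)
  ; _≺_ = λ w v → toℕ v < toℕ w
  ; inhabW = Fin.zero
  ; U = ℕ
  ; D = λ w d → toℕ w ≤ d
  ; Dne = λ w → toℕ w , ≤-refl
  ; Dmono = λ v<w w≤d → ≤-trans (<⇒≤ v<w) w≤d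
  }

chain-height : ∀ L k (w : Fin (suc L)) → toℕ w ≤ k → HeightLe (Chain L) k w
chain-height L zero w w≤0 v v<w with ≤-trans v<w w≤0
... | ()
chain-height L (suc k) w w≤k v v<w = chain-height L k v (≤-pred (≤-trans v<w w≤k))

chain-transitive : ∀ L → Transitive (Chain L)
chain-transitive L u≺v v≺w = <-trans v≺w u≺v

chain∈FH : ∀ L → FH (Chain L)
chain∈FH L = chain-transitive L , finiteHeight⇒cwf (Chain L) height , height
  where
    height : FiniteHeight (Chain L)
    height = L , λ w → chain-height L L w (toℕ≤pred[n] w)

chain∈FI : ∀ L → FI (Chain L)
chain∈FI L = (suc L , (λ w → w) , λ w → w , refl) , chain-transitive L , <-irrefl refl

-- Modal depth, counting two per box: a box has to tell an immediate
-- predecessor apart from the others.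
depth : Fm → ℕ
depth ⊤ᶠ = 0
depth ⊥ᶠ = 0
depth (atom n k xs) = 0
depth (¬ᶠ B) = depth B
depth (B ⇒ C) = depth B ⊔ depth C
depth (∀ᶠ x B) = depth B
depth (□ B) = 2 + depth B

-- Interpretations in which an atom at world w only sees the offsets of its
-- arguments from w, described by the predicate Marks on offset vectors.
module Invariance (L : ℕ) (Marks : (n k : ℕ) → Vec ℕ n → Set) where

  F : Frame
  F = Chain L

  I : Interp F
  I w n k ds = Marks n k (map (offset (toℕ w)) ds)

  Sat : Fm → Fin (suc L) → (ℕ → ℕ) → Set
  Sat B = ⟦_⟧ F B I

  record Matching (a : ℕ) (ρ : ℕ → ℕ) (b : ℕ) (ρ' : ℕ → ℕ) : Set where
    constructor matching
    field same-offset : ∀ x → offset a (ρ x) ≡ offset b (ρ' x)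
  open Matching

  matching-sym : ∀ {a ρ b ρ'} → Matching a ρ b ρ' → Matching b ρ' a ρ
  matching-sym m = matching λ x → sym (same-offset m x)

  matching-update : ∀ {a ρ b ρ'} → Matching a ρ b ρ' → ∀ x d d' →
                    offset a d ≡ offset b d' → Matching a (update F ρ x d) b (update F ρ' x d')
  matching-update {a} {ρ} {b} {ρ'} m x d d' e = matching updated
    where
      updated : ∀ y → offset a (update F ρ x d y) ≡ offset b (update F ρ' x d' y)
      updated y with x ≟ y
      ... | yes _ = e
      ... | no _ = same-offset m y

  matching-down : ∀ {w w' v v' : Fin (suc L)} {ρ ρ'} → toℕ v < toℕ w → toℕ v' < toℕ w' →
                  Admissible F w ρ → Admissible F w' ρ' →
                  offset (toℕ v) (toℕ w) ≡ offset (toℕ v') (toℕ w') →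
                  Matching (toℕ w) ρ (toℕ w') ρ' → Matching (toℕ v) ρ (toℕ v') ρ'
  matching-down {w} {w'} {v} {v'} {ρ} {ρ'} v<w v'<w' adm adm' e m = matching λ x → begin
    offset (toℕ v) (ρ x)                                  ≡⟨ offset-trans (<⇒≤ v<w) (adm x) ⟩
    cap (offset (toℕ w) (ρ x) + offset (toℕ v) (toℕ w))   ≡⟨ cong cap (cong₂ _+_ (same-offset m x) e) ⟩
    cap (offset (toℕ w') (ρ' x) + offset (toℕ v') (toℕ w')) ≡⟨ sym (offset-trans (<⇒≤ v'<w') (adm' x)) ⟩
    offset (toℕ v') (ρ' x)                                ∎

  admissible-below : ∀ {w v : Fin (suc L)} {ρ} → toℕ v < toℕ w → Admissible F w ρ → Admissible F v ρ
  admissible-below v<w adm x = Frame.Dmono F v<w (adm x)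

  admissible-update : ∀ {w ρ} → Admissible F w ρ → ∀ x {d} → toℕ w ≤ d →
                      Admissible F w (update F ρ x d)
  admissible-update adm x w≤d y with x ≟ y
  ... | yes _ = w≤d
  ... | no _ = adm y

  worldAt : ∀ c → c < suc L → Σ (Fin (suc L)) λ v → toℕ v ≡ c
  worldAt c c<1+L = fromℕ< c<1+L , toℕ-fromℕ< c<1+L

  successor-match : ∀ {n} {w w' v' : Fin (suc L)} → Agree (2 + n) (toℕ w) (toℕ w') →
                    toℕ v' < toℕ w' →
                    Σ (Fin (suc L)) λ v → toℕ v < toℕ w × Agree n (toℕ v) (toℕ v')
                                         × offset (toℕ v) (toℕ w) ≡ offset (toℕ v') (toℕ w')
  successor-match {w = w} ag v'<w' with agree-successor ag v'<w'
  ... | c , c<w , ag' , e with worldAt c (<-trans c<w (toℕ<n w))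
  ... | v , refl = v , c<w , ag' , e

  offsets-agree : ∀ {a ρ b ρ' n} → Matching a ρ b ρ' → (xs : Vec ℕ n) →
                  map (offset a) (map ρ xs) ≡ map (offset b) (map ρ' xs)
  offsets-agree {a} {ρ} {b} {ρ'} m xs = begin
    map (offset a) (map ρ xs)   ≡⟨ sym (map-∘ (offset a) ρ xs) ⟩
    map (offset a ∘ ρ) xs       ≡⟨ map-cong (same-offset m) xs ⟩
    map (offset b ∘ ρ') xs      ≡⟨ map-∘ (offset b) ρ' xs ⟩
    map (offset b) (map ρ' xs)  ∎

  invariance : ∀ B {w w' : Fin (suc L)} {ρ ρ'} → Agree (depth B) (toℕ w) (toℕ w') →
               Admissible F w ρ → Admissible F w' ρ' → Matching (toℕ w) ρ (toℕ w') ρ' →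
               Sat B w ρ → Sat B w' ρ'
  invariance ⊤ᶠ ag adm adm' m h = h
  invariance ⊥ᶠ ag adm adm' m h = h
  invariance (atom n k xs) ag adm adm' m h = subst (Marks n k) (offsets-agree m xs) h
  invariance (¬ᶠ B) {w} {w'} {ρ} {ρ'} ag adm adm' m h h' =
    h (invariance B {w'} {w} {ρ'} {ρ} (sym ag) adm' adm (matching-sym m) h')
  invariance (B ⇒ C) {w} {w'} {ρ} {ρ'} ag adm adm' m h h' =
    invariance C {w} {w'} {ρ} {ρ'} (agree-mono (m≤n⊔m (depth B) (depth C)) ag) adm adm' m
      (h (invariance B {w'} {w} {ρ'} {ρ} (sym (agree-mono (m≤m⊔n (depth B) (depth C)) ag))
            adm' adm (matching-sym m) h'))
  invariance (∀ᶠ x B) {w} {w'} {ρ} {ρ'} ag adm adm' m h d' w'≤d' =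
    invariance B {w} {w'} {update F ρ x d} {update F ρ' x d'} ag
      (admissible-update adm x w≤d) (admissible-update adm' x w'≤d')
      (matching-update m x d d' (offset-shift (toℕ w) (d' ∸ toℕ w'))) (h d w≤d)
    where
      -- the witness above w at the same offset as d' above w'
      d : ℕ
      d = toℕ w + offset (toℕ w') d'
      w≤d : toℕ w ≤ d
      w≤d = m≤m+n (toℕ w) (offset (toℕ w') d')
  invariance (□ B) {w} {w'} {ρ} {ρ'} ag adm adm' m h v' v'<w'
    with successor-match {depth B} {w} {w'} {v'} ag v'<w'
  ... | v , v<w , ag' , e =
    invariance B {v} {v'} {ρ} {ρ'} ag' (admissible-below v<w adm)
      (admissible-below v'<w' adm') (matching-down {w} {w'} {v} {v'} v<w v'<w' adm adm' e m)
      (h v v<w)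

  -- the assignment sending every variable above all worlds by at least 2
  far : ℕ → ℕ
  far _ = 2 + L

  far-admissible : ∀ (w : Fin (suc L)) → Admissible F w far
  far-admissible w _ = ≤-trans (toℕ≤pred[n] w) (≤-trans (n≤1+n L) (n≤1+n (suc L)))

  far-matching : ∀ (w w' : Fin (suc L)) → Matching (toℕ w) far (toℕ w') far
  far-matching w w' = matching λ _ → trans (offset-far (s≤s (s≤s (toℕ≤pred[n] w))))
                                           (sym (offset-far (s≤s (s≤s (toℕ≤pred[n] w')))))

  high-worlds-agree : ∀ B (w w' : Fin (suc L)) → depth B ≤ toℕ w → depth B ≤ toℕ w' →
                      Sat B w far → Sat B w' far
  high-worlds-agree B w w' hw hw' =
    invariance B (agree-above hw hw') (far-admissible w) (far-admissible w') (far-matching w w')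

-- A(p) = ∀x₀ (Q x₀ → □ (R x₀ → ¬ p)) with Q, R the unary symbols 0 and 1.
A : Fm'
A = ∀ᶠ 0 (atom 1 0 (0 ∷ []) ⇒ (□ (atom 1 1 (0 ∷ []) ⇒ (¬ᶠ ‵p))))

A-modalized : Modalized A
A-modalized = _ , _

-- At world w: Q marks w itself (offset 0) and R marks w + 1 (offset 1).
markers : (n k : ℕ) → Vec ℕ n → Set
markers 1 0 (o ∷ []) = o ≡ 0
markers 1 1 (o ∷ []) = o ≡ 1
markers _ _ _ = Empty

-- B holds at the even worlds and fails at the odd ones
even : ℕ → Bool
even zero = true
even (suc n) = not (even n)

Truth : Bool → Set → Set
Truth true P = P
Truth false P = ¬ P

module FixedPoint (L : ℕ) (B : Fm) (fixed : ValidIff (Chain L) B (subst-p A B)) where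
  open Invariance L markers

  ValueAt : ℕ → Bool → Set
  ValueAt m b = ∀ v ρ → toℕ v ≡ m → Admissible F v ρ → Truth b (Sat B v ρ)

  -- A(B) holds vacuously at the bottom world
  holds-at-bottom : ValueAt 0 true
  holds-at-bottom v ρ v≡0 adm = proj₂ (fixed I v ρ adm)
    λ d v≤d q u u<v r _ → nothing-below-0 (≤-trans u<v (≤-reflexive v≡0))
    where
      nothing-below-0 : ∀ {k} → suc k ≤ 0 → Empty
      nothing-below-0 ()

  -- where B fails at height m it holds at height m + 1: the only x₀ with
  -- Q x₀ at m + 1 is m + 1, whose only R-successor is the world m
  holds-above-failure : ∀ m → ValueAt m false → ValueAt (suc m) true
  holds-above-failure m below w ρ w≡1+m adm = proj₂ (fixed I w ρ adm)
    λ d w≤d q u u<w r → below u (update F ρ 0 d) (height-of u (offset≡0 w≤d q) (offset≡1 r))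
                               (admissible-update (admissible-below u<w adm) 0 (Frame.Dmono F u<w w≤d))
    where
      height-of : ∀ u {d} → d ≡ toℕ w → d ≡ suc (toℕ u) → toℕ u ≡ m
      height-of u d≡w d≡1+u = suc-injective (trans (sym d≡1+u) (trans d≡w w≡1+m))

  -- where B holds at height m it fails at height m + 1, refuted by x₀ = m + 1
  fails-above-truth : ∀ m → ValueAt m true → ValueAt (suc m) false
  fails-above-truth m below w ρ w≡1+m adm hw =
    proj₁ (fixed I w ρ adm) hw (suc m) (≤-reflexive w≡1+m) q v v<w r
      (below v (update F ρ 0 (suc m)) v≡m (admissible-update (admissible-below v<w adm) 0 v≤1+m))
    where
      lower : Σ (Fin (suc L)) λ v → toℕ v ≡ m
      lower = worldAt m (<-trans (≤-reflexive (sym w≡1+m)) (toℕ<n w))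
      v : Fin (suc L)
      v = proj₁ lower
      v≡m : toℕ v ≡ m
      v≡m = proj₂ lower
      v<w : toℕ v < toℕ w
      v<w = ≤-trans (s≤s (≤-reflexive v≡m)) (≤-reflexive (sym w≡1+m))
      v≤1+m : toℕ v ≤ suc m
      v≤1+m = ≤-trans (≤-reflexive v≡m) (n≤1+n m)
      q : offset (toℕ w) (suc m) ≡ 0
      q = trans (cong (λ x → offset x (suc m)) w≡1+m) (offset-self (suc m))
      r : offset (toℕ v) (suc m) ≡ 1
      r = trans (cong (λ x → offset x (suc m)) v≡m) (offset-suc m)

  fixedPoint-parity : ∀ m → ValueAt m (even m)
  fixedPoint-parity zero = holds-at-bottom
  fixedPoint-parity (suc m) with even m | fixedPoint-parity m
  ... | true | below = fails-above-truth m below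
  ... | false | below = holds-above-failure m below

opposite-values : ∀ b {P Q : Set} → Truth b P → Truth (not b) Q → (P → Q) → (Q → P) → Empty
opposite-values true p ¬q p→q q→p = ¬q (p→q p)
opposite-values false ¬p q p→q q→p = ¬p (q→p q)

-- Any class containing all chains lacks the fixed-point property: a fixed
-- point B of A would alternate on the chain of length depth B + 1 but cannot
-- separate its two top worlds.
noFixedPoint : (C : Frame → Set) → (∀ L → C (Chain L)) → ¬ FixedPointProperty C
noFixedPoint C chains∈C fpp with fpp A A-modalized
... | B , _ , fixed =
  opposite-values (even n) (parity w₀ w₀≡n) (parity w₁ w₁≡1+n)
    (high-worlds-agree B w₀ w₁ n≤w₀ n≤w₁) (high-worlds-agree B w₁ w₀ n≤w₁ n≤w₀)
  where
    n : ℕ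
    n = depth B
    open Invariance (suc n) markers
    open FixedPoint (suc n) B (fixed (Chain (suc n)) (chains∈C (suc n)))
    top₀ : Σ (Fin (suc (suc n))) λ v → toℕ v ≡ n
    top₀ = worldAt n (n≤1+n (suc n))
    top₁ : Σ (Fin (suc (suc n))) λ v → toℕ v ≡ suc n
    top₁ = worldAt (suc n) ≤-refl
    w₀ w₁ : Fin (suc (suc n))
    w₀ = proj₁ top₀
    w₁ = proj₁ top₁
    w₀≡n : toℕ w₀ ≡ n
    w₀≡n = proj₂ top₀
    w₁≡1+n : toℕ w₁ ≡ suc n
    w₁≡1+n = proj₂ top₁
    n≤w₀ : n ≤ toℕ w₀
    n≤w₀ = ≤-reflexive (sym w₀≡n)
    n≤w₁ : n ≤ toℕ w₁
    n≤w₁ = ≤-trans (n≤1+n n) (≤-reflexive (sym w₁≡1+n))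
    parity : ∀ {m} (w : Fin (suc (suc n))) → toℕ w ≡ m → Truth (even m) (Sat B w far)
    parity {m} w w≡m = fixedPoint-parity m w far w≡m (far-admissible w)

corollary3p7 : ¬ FixedPointProperty FH × ¬ FixedPointProperty FI
corollary3p7 = noFixedPoint FH chain∈FH , noFixedPoint FI chain∈FI
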